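{- Let $t$ be an arbor on a set of cardinality $n\ge 2$, let $r$ be the cardinality of the root vertex of $t$, and let $t_1,\dots,t_{\mathsf w}$ ($\mathsf w\ge 0$) be the sub-trees hanging from the root vertex. Let $m\ge 1$ be an integer, let $F_{W,m}=\prod_{k=1}^{\mathsf w}F_{t_k,m}$ (equal to $1$ if $\mathsf w=0$) and write $F_{W,m}=\sum_j W_jX^j$. Then for $0\le j\le mn$, the coefficient of $X^j$ in $F_{t,m}$ is $$\sum_{\ell=\max(0,\,j+m(r-n))}^{j}\binom{r+\ell-1}{\ell}W_{j-\ell}.$$
   Context: An arbor on a finite non-empty set $I$ is a rooted tree whose vertices are labeled by pairwise disjoint non-empty subsets of $I$ whose union is $I$; we identify a vertex with its label set. For a vertex $v$, $\mathscr{D}(v)$ is the union of the labels of all vertices whose path to the root passes through $v$ (including $v$). The polytope $Q_t\subset \mathbb{R}^I$ is defined by $x_i\ge 0$ for $i\in I$ and $\sum_{i\in\mathscr{D}(v)}x_i\le|\mathscr{D}(v)|$ for every vertex $v$. The height of a point is the sum of its coordinates. For an integer $m\ge1$, $F_{t,m}(X)=\sum_{p}X^{\mathrm{ht}(p)}$, the sum over all lattice points $p\in\mathbb{Z}^I$ of the dilate $mQ_t$. For a sub-tree $t_k$ (itself an arbor on the union of its labels), $F_{t_k,m}$ is defined the same way. We use $\binom{r-1}{0}=1$. -}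

module Defs where

open import Data.Nat using (ℕ; zero; suc; _+_; _*_; _∸_; _≤_; _≤?_)
open import Data.Nat.Properties using (_≟_)
open import Data.Bool using (Bool; true; false; if_then_else_)
open import Data.Fin using (Fin)
open import Data.Fin.Subset using (Subset; ⊤; ⋃; _∩_; ∣_∣; Nonempty; Empty)
open import Data.Vec using (Vec; []; _∷_; zipWith)
import Data.Vec as V
open import Data.List using (List; []; _∷_; _++_; map; concatMap; length; filter; upTo; foldr)
open import Data.Nat.ListAction using (sum)
open import Data.List.Relation.Unary.All using (All; all?)
open import Data.List.Relation.Unary.AllPairs using (AllPairs)
open import Relation.Binary.PropositionalEquality using (_≡_)
open import Relation.Nullary.Decidable using (_×-dec_)
open import Data.Product using (_×_)

data Tree (n : ℕ) : Set where
  node : Subset n → List (Tree n) → Tree n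

rootLabel : ∀ {n} → Tree n → Subset n
rootLabel (node l _) = l

children : ∀ {n} → Tree n → List (Tree n)
children (node _ cs) = cs

mutual
  labels : ∀ {n} → Tree n → List (Subset n)
  labels (node l cs) = l ∷ labelsF cs

  labelsF : ∀ {n} → List (Tree n) → List (Subset n)
  labelsF [] = []
  labelsF (t ∷ ts) = labels t ++ labelsF ts

mutual
  subtrees : ∀ {n} → Tree n → List (Tree n)
  subtrees (node l cs) = node l cs ∷ subtreesF cs

  subtreesF : ∀ {n} → List (Tree n) → List (Tree n)
  subtreesF [] = []
  subtreesF (t ∷ ts) = subtrees t ++ subtreesF ts

𝒟 : ∀ {n} → Tree n → Subset n
𝒟 t = ⋃ (labels t)

IsArbor : ∀ {n} → Tree n → Set
IsArbor {n} t =
  All Nonempty (labels t) ×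
  AllPairs (λ a b → Empty (a ∩ b)) (labels t) ×
  (⋃ (labels t) ≡ ⊤)

sumOn : ∀ {n} → Subset n → Vec ℕ n → ℕ
sumOn p x = V.sum (zipWith (λ b y → if b then y else 0) p x)

ht : ∀ {n} → Vec ℕ n → ℕ
ht x = V.sum x

-- all x ∈ ℕ^n with x_i ∈ {0..b} for i ∈ p and x_i = 0 for i ∉ p
-- (these represent the points of {0..b}^p ⊂ ℤ^p)
box : ∀ {n} → Subset n → ℕ → List (Vec ℕ n)
box {zero} [] b = [] ∷ []
box {suc n} (true ∷ p) b = concatMap (λ k → map (k ∷_) (box p b)) (upTo (suc b))
box {suc n} (false ∷ p) b = map (0 ∷_) (box p b)

-- x lies in the dilate m Q_s (x ≥ 0 is automatic for ℕ-vectors)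
InDilate : ∀ {n} → ℕ → Tree n → Vec ℕ n → Set
InDilate m s x = All (λ v → sumOn (𝒟 v) x ≤ m * ∣ 𝒟 v ∣) (subtrees s)

-- coefficient of X^j in F_{s,m}: the number of lattice points of m Q_s ⊂ ℝ^{𝒟(s)}
-- of height j (lattice points of ℤ^{𝒟(s)} are represented as vectors in ℕ^n
-- vanishing outside 𝒟(s); a point of height j has all coordinates ≤ j).
Fcoeff : ∀ {n} → Tree n → ℕ → ℕ → ℕ
Fcoeff s m j =
  length (filter (λ x → (ht x ≟ j) ×-dec all? (λ v → sumOn (𝒟 v) x ≤? m * ∣ 𝒟 v ∣) (subtrees s))
                 (box (𝒟 s) j))

-- polynomials as coefficient functions; the constant 1 and products
one : ℕ → ℕ
one zero = 1
one (suc _) = 0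

conv : (ℕ → ℕ) → (ℕ → ℕ) → ℕ → ℕ
conv f g j = sum (map (λ i → f i * g (j ∸ i)) (upTo (suc j)))

prodPoly : List (ℕ → ℕ) → ℕ → ℕ
prodPoly = foldr conv one

sumFromTo : ℕ → ℕ → (ℕ → ℕ) → ℕ
sumFromTo lo hi f = sum (map (λ k → f (lo + k)) (upTo (suc (hi ∸ lo))))

-- A lattice point of m·Q_t of height j ≤ m·n satisfies the root inequality Σ_I x_i ≤ m·n
-- automatically. Every other inequality belongs to a vertex of some hanging subtree t_k and
-- only involves the coordinates in 𝒟(t_k); as these sets and the root label are pairwise
-- disjoint, counting points by height turns the constraint system into a product of generating
-- functions, (1 − X)^(−r) · ∏ F_{t_k,m}. The coefficient of X^ℓ in (1 − X)^(−r) is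
-- C(r + ℓ − 1, ℓ), and the lower summation bound comes from deg F_{W,m} ≤ m(n − r).
module Submission where

open import Defs
open import Data.Bool using (Bool; true; false; if_then_else_; _∧_)
open import Data.Bool.Properties using (∧-assoc; ∧-comm)
open import Data.Empty using (⊥-elim)
open import Data.Fin using (zero)
open import Data.Fin.Subset
  using (Subset; inside; outside; _∪_; _∩_; ⋃; ∣_∣; Empty; _⊆_)
  renaming (⊥ to ∅)
open import Data.Fin.Subset.Properties
  using (∣⊤∣≡n; ∣⊥∣≡0; ∉⊥; drop-∷-⊆; drop-∷-Empty; ⊆-refl; p⊆p∪q; q⊆p∪q;
         x∈p∪q⁻; x∈p∩q⁺; x∈p∩q⁻; ∪-assoc; ∪-comm; ∩-comm; ∪-identityˡ)
open import Data.List using (List; []; _∷_; _++_; map; concatMap; length; filter; upTo; applyUpTo)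
open import Data.List.Relation.Unary.All as All using (All; []; _∷_; all?)
open import Data.List.Relation.Unary.AllPairs using (AllPairs; []; _∷_)
open import Data.List.Relation.Unary.All.Properties using (++⁺; ++⁻ʳ)
open import Data.Nat
open import Data.Nat.Combinatorics using (_C_; nCk+nC[k+1]≡[n+1]C[k+1]; k>n⇒nCk≡0)
open import Data.Nat.ListAction using (sum)
open import Data.Nat.Properties
open import Algebra.Properties.CommutativeSemigroup +-commutativeSemigroup using (interchange)
open import Data.Product using (_×_; _,_)
open import Data.Sum using (inj₁; inj₂)
open import Data.Vec using (Vec; []; _∷_; here)
open import Function using (_∘_; id)
open import Function.Bundles using (mk⇔)
open import Relation.Binary.PropositionalEquality
open import Relation.Nullary using (does; yes; no)
open import Relation.Nullary.Decidable using (dec-true; dec-false; does-⇔)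
open import Relation.Unary using (Decidable)

∑ : ℕ → (ℕ → ℕ) → ℕ
∑ zero    f = 0
∑ (suc n) f = f 0 + ∑ n (f ∘ suc)

infix 6.5 ∑
syntax ∑ n (λ i → e) = ∑[ i < n ] e

∑-cong : ∀ n {f g : ℕ → ℕ} → (∀ i → i < n → f i ≡ g i) → ∑ n f ≡ ∑ n g
∑-cong zero    eq = refl
∑-cong (suc n) eq = cong₂ _+_ (eq 0 z<s) (∑-cong n (λ i i<n → eq (suc i) (s<s i<n)))

∑-zero : ∀ n {f : ℕ → ℕ} → (∀ i → i < n → f i ≡ 0) → ∑ n f ≡ 0
∑-zero zero    eq = refl
∑-zero (suc n) eq = cong₂ _+_ (eq 0 z<s) (∑-zero n (λ i i<n → eq (suc i) (s<s i<n)))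

∑-+ : ∀ n (f g : ℕ → ℕ) → ∑[ i < n ] (f i + g i) ≡ ∑ n f + ∑ n g
∑-+ zero    f g = refl
∑-+ (suc n) f g = trans (cong (f 0 + g 0 +_) (∑-+ n (f ∘ suc) (g ∘ suc)))
                        (interchange (f 0) (g 0) (∑ n (f ∘ suc)) (∑ n (g ∘ suc)))

∑-*ʳ : ∀ n (f : ℕ → ℕ) c → ∑[ i < n ] (f i * c) ≡ ∑ n f * c
∑-*ʳ zero    f c = refl
∑-*ʳ (suc n) f c = trans (cong (f 0 * c +_) (∑-*ʳ n (f ∘ suc) c))
                         (sym (*-distribʳ-+ c (f 0) (∑ n (f ∘ suc))))

∑-last : ∀ n (f : ℕ → ℕ) → ∑ (suc n) f ≡ ∑ n f + f n
∑-last zero    f = +-identityʳ (f 0)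
∑-last (suc n) f = trans (cong (f 0 +_) (∑-last n (f ∘ suc))) (sym (+-assoc (f 0) _ _))

∑-split : ∀ a b (f : ℕ → ℕ) → ∑ (a + b) f ≡ ∑ a f + ∑[ k < b ] f (a + k)
∑-split zero    b f = refl
∑-split (suc a) b f = trans (cong (f 0 +_) (∑-split a b (f ∘ suc))) (sym (+-assoc (f 0) _ _))

∑-trailing-zeros : ∀ {a b} (f : ℕ → ℕ) → a ≤ b → (∀ i → a ≤ i → f i ≡ 0) → ∑ b f ≡ ∑ a f
∑-trailing-zeros {a} {b} f a≤b zeros = begin
  ∑ b f                                  ≡⟨ cong (λ c → ∑ c f) (m+[n∸m]≡n a≤b) ⟨
  ∑ (a + (b ∸ a)) f                      ≡⟨ ∑-split a (b ∸ a) f ⟩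
  ∑ a f + ∑[ k < b ∸ a ] f (a + k)       ≡⟨ cong (∑ a f +_) (∑-zero (b ∸ a) (λ k _ → zeros (a + k) (m≤m+n a k))) ⟩
  ∑ a f + 0                              ≡⟨ +-identityʳ _ ⟩
  ∑ a f                                  ∎
  where open ≡-Reasoning

∑-leading-zeros : ∀ a b (f : ℕ → ℕ) → (∀ i → i < a → f i ≡ 0) → ∑ (a + b) f ≡ ∑[ k < b ] f (a + k)
∑-leading-zeros a b f zeros =
  trans (∑-split a b f) (cong (_+ ∑[ k < b ] f (a + k)) (∑-zero a zeros))

∑-reverse : ∀ n (f : ℕ → ℕ) → ∑ n f ≡ ∑[ i < n ] f (n ∸ suc i)
∑-reverse zero    f = refl
∑-reverse (suc n) f = begin
  f 0 + ∑ n (f ∘ suc)                                  ≡⟨ cong (f 0 +_) (∑-reverse n (f ∘ suc)) ⟩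
  f 0 + ∑[ i < n ] f (suc (n ∸ suc i))                 ≡⟨ +-comm (f 0) _ ⟩
  ∑[ i < n ] f (suc (n ∸ suc i)) + f 0                 ≡⟨ cong₂ _+_ (∑-cong n (λ i i<n → cong f (+-∸-assoc 1 i<n)))
                                                                    (cong f (n∸n≡0 n)) ⟨
  ∑[ i < n ] f (suc n ∸ suc i) + f (suc n ∸ suc n)     ≡⟨ ∑-last n (λ i → f (suc n ∸ suc i)) ⟨
  ∑[ i < suc n ] f (suc n ∸ suc i)                     ∎
  where open ≡-Reasoning

∑-triangle : ∀ j (G : ℕ → ℕ → ℕ) →
  ∑[ a < suc j ] ∑[ b < suc (j ∸ a) ] G a b ≡ ∑[ s < suc j ] ∑[ a < suc s ] G a (s ∸ a)
∑-triangle zero    G = refl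
∑-triangle (suc j) G = begin
  ∑ (suc (suc j)) (G 0) + ∑[ a < suc j ] ∑[ b < suc (j ∸ a) ] G (suc a) b
    ≡⟨ cong (∑ (suc (suc j)) (G 0) +_) (∑-triangle j (G ∘ suc)) ⟩
  G 0 0 + ∑[ s < suc j ] G 0 (suc s) + rest
    ≡⟨ +-assoc (G 0 0) _ _ ⟩
  G 0 0 + (∑[ s < suc j ] G 0 (suc s) + rest)
    ≡⟨ cong (G 0 0 +_) (∑-+ (suc j) (λ s → G 0 (suc s)) (λ s → ∑[ a < suc s ] G (suc a) (s ∸ a))) ⟨
  G 0 0 + ∑[ s < suc j ] (G 0 (suc s) + ∑[ a < suc s ] G (suc a) (s ∸ a))
    ≡⟨ cong (_+ ∑[ s < suc j ] (G 0 (suc s) + ∑[ a < suc s ] G (suc a) (s ∸ a))) (+-identityʳ (G 0 0)) ⟨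
  G 0 0 + 0 + ∑[ s < suc j ] (G 0 (suc s) + ∑[ a < suc s ] G (suc a) (s ∸ a))
    ∎
  where
  open ≡-Reasoning
  rest : ℕ
  rest = ∑[ s < suc j ] ∑[ a < suc s ] G (suc a) (s ∸ a)

sum-map-applyUpTo : ∀ n (f g : ℕ → ℕ) → sum (map f (applyUpTo g n)) ≡ ∑ n (f ∘ g)
sum-map-applyUpTo zero    f g = refl
sum-map-applyUpTo (suc n) f g = cong (f (g 0) +_) (sum-map-applyUpTo n f (g ∘ suc))

infixl 7 _⋆_

_⋆_ : (ℕ → ℕ) → (ℕ → ℕ) → ℕ → ℕ
(f ⋆ g) j = ∑[ i < suc j ] f i * g (j ∸ i)

conv≡⋆ : ∀ f g j → conv f g j ≡ (f ⋆ g) j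
conv≡⋆ f g j = sum-map-applyUpTo (suc j) (λ i → f i * g (j ∸ i)) id

⋆-comm : ∀ f g j → (f ⋆ g) j ≡ (g ⋆ f) j
⋆-comm f g j = begin
  ∑[ i < suc j ] f i * g (j ∸ i)                   ≡⟨ ∑-reverse (suc j) (λ i → f i * g (j ∸ i)) ⟩
  ∑[ i < suc j ] f (j ∸ i) * g (j ∸ (j ∸ i))       ≡⟨ ∑-cong (suc j) (λ i i≤j →
                                                        trans (*-comm (f (j ∸ i)) (g (j ∸ (j ∸ i))))
                                                              (cong (λ k → g k * f (j ∸ i)) (m∸[m∸n]≡n (≤-pred i≤j)))) ⟩
  ∑[ i < suc j ] g i * f (j ∸ i)                   ∎
  where open ≡-Reasoning

⋆-cong : ∀ {f f′ g g′ : ℕ → ℕ} → (∀ i → f i ≡ f′ i) → (∀ i → g i ≡ g′ i) → ∀ j → (f ⋆ g) j ≡ (f′ ⋆ g′) j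
⋆-cong f≗f′ g≗g′ j = ∑-cong (suc j) (λ i _ → cong₂ _*_ (f≗f′ i) (g≗g′ (j ∸ i)))

-- The left side is the coefficient of X^j in (Σ_k X^k H_k(X)) · g(X).
∑-shifted-⋆ : ∀ (H : ℕ → ℕ → ℕ) g j →
  ∑[ k < suc j ] (H k ⋆ g) (j ∸ k) ≡ ((λ i → ∑[ k < suc i ] H k (i ∸ k)) ⋆ g) j
∑-shifted-⋆ H g j = begin
  ∑[ k < suc j ] ∑[ i < suc (j ∸ k) ] H k i * g (j ∸ k ∸ i)
    ≡⟨ ∑-triangle j (λ k i → H k i * g (j ∸ k ∸ i)) ⟩
  ∑[ s < suc j ] ∑[ a < suc s ] H a (s ∸ a) * g (j ∸ a ∸ (s ∸ a))
    ≡⟨ ∑-cong (suc j) (λ s _ → ∑-cong (suc s) (λ a a≤s →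
         cong (λ k → H a (s ∸ a) * g k)
              (trans (∸-+-assoc j a (s ∸ a)) (cong (j ∸_) (m+[n∸m]≡n (≤-pred a≤s)))))) ⟩
  ∑[ s < suc j ] ∑[ a < suc s ] H a (s ∸ a) * g (j ∸ s)
    ≡⟨ ∑-cong (suc j) (λ s _ → ∑-*ʳ (suc s) (λ a → H a (s ∸ a)) (g (j ∸ s))) ⟩
  ∑[ s < suc j ] (∑[ a < suc s ] H a (s ∸ a)) * g (j ∸ s)
    ∎
  where open ≡-Reasoning

DegreeAtMost : ℕ → (ℕ → ℕ) → Set
DegreeAtMost d f = ∀ i → d < i → f i ≡ 0

⋆-degree : ∀ {a b} {f g : ℕ → ℕ} → DegreeAtMost a f → DegreeAtMost b g → DegreeAtMost (a + b) (f ⋆ g)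
⋆-degree {a} {b} {f} {g} deg-f deg-g d a+b<d = ∑-zero (suc d) (λ i i≤d → term-zero i (≤-pred i≤d))
  where
  term-zero : ∀ i → i ≤ d → f i * g (d ∸ i) ≡ 0
  term-zero i i≤d with a <? i
  ... | yes a<i = cong (_* g (d ∸ i)) (deg-f i a<i)
  ... | no  a≮i = trans (cong (f i *_) (deg-g (d ∸ i) b<d∸i)) (*-zeroʳ (f i))
    where
    b<d∸i : b < d ∸ i
    b<d∸i = m+n≤o⇒m≤o∸n (suc b) (≤-trans (+-monoʳ-≤ (suc b) (≮⇒≥ a≮i))
                                         (subst (_≤ d) (cong suc (+-comm a b)) a+b<d))

⋆-truncate : ∀ (f g : ℕ → ℕ) K → DegreeAtMost K g →
  ∀ j → (f ⋆ g) j ≡ sumFromTo (j ∸ K) j (λ ℓ → f ℓ * g (j ∸ ℓ))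
⋆-truncate f g K deg-g j = begin
  ∑ (suc j) term                        ≡⟨ cong (λ c → ∑ c term) length-split ⟨
  ∑ (lo + suc (j ∸ lo)) term            ≡⟨ ∑-leading-zeros lo (suc (j ∸ lo)) term low-terms-zero ⟩
  ∑[ k < suc (j ∸ lo) ] term (lo + k)   ≡⟨ sum-map-applyUpTo (suc (j ∸ lo)) (λ k → term (lo + k)) id ⟨
  sumFromTo lo j term                   ∎
  where
  open ≡-Reasoning
  term : ℕ → ℕ
  term ℓ = f ℓ * g (j ∸ ℓ)
  lo : ℕ
  lo = j ∸ K
  length-split : lo + suc (j ∸ lo) ≡ suc j
  length-split = trans (+-suc lo (j ∸ lo)) (cong suc (m+[n∸m]≡n (m∸n≤m j K)))
  low-terms-zero : ∀ ℓ → ℓ < lo → term ℓ ≡ 0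
  low-terms-zero ℓ ℓ<lo = trans (cong (f ℓ *_) (deg-g (j ∸ ℓ) K<j∸ℓ)) (*-zeroʳ (f ℓ))
    where
    K<j∸ℓ : K < j ∸ ℓ
    K<j∸ℓ = m∸n≢0⇒n<m λ eq → <⇒≱ ℓ<lo (m∸n≡0⇒m≤n (begin
      j ∸ K ∸ ℓ   ≡⟨ ∸-+-assoc j K ℓ ⟩
      j ∸ (K + ℓ) ≡⟨ cong (j ∸_) (+-comm K ℓ) ⟩
      j ∸ (ℓ + K) ≡⟨ ∸-+-assoc j ℓ K ⟨
      j ∸ ℓ ∸ K   ≡⟨ eq ⟩
      0           ∎))

restrict : ∀ {n} → Subset n → Vec ℕ n → Vec ℕ n
restrict []            []      = []
restrict (inside  ∷ p) (k ∷ x) = k ∷ restrict p x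
restrict (outside ∷ p) (k ∷ x) = 0 ∷ restrict p x

DependsOn : ∀ {n} → Subset n → (Vec ℕ n → Bool) → Set
DependsOn p A = ∀ x → A x ≡ A (restrict p x)

-- count p A j is the number of x ∈ ℕⁿ supported on p with x₀ + ⋯ + xₙ₋₁ = j and A x = true.
count : ∀ {n} → Subset n → (Vec ℕ n → Bool) → ℕ → ℕ
count []            A zero    = if A [] then 1 else 0
count []            A (suc j) = 0
count (inside  ∷ p) A j       = ∑[ k < suc j ] count p (λ y → A (k ∷ y)) (j ∸ k)
count (outside ∷ p) A j       = count p (λ y → A (0 ∷ y)) j

count-cong : ∀ {n} (p : Subset n) {A B : Vec ℕ n → Bool} j →
  (∀ x → sumOn p x ≡ j → A x ≡ B x) → count p A j ≡ count p B j
count-cong []            zero    A≗B = cong (λ b → if b then 1 else 0) (A≗B [] refl)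
count-cong []            (suc j) A≗B = refl
count-cong (inside  ∷ p) j       A≗B = ∑-cong (suc j) λ k k≤j →
  count-cong p (j ∸ k) λ y sum≡ → A≗B (k ∷ y) (trans (cong (k +_) sum≡) (m+[n∸m]≡n (≤-pred k≤j)))
count-cong (outside ∷ p) j       A≗B = count-cong p j λ y → A≗B (0 ∷ y)

count-vanishing : ∀ {n} (p : Subset n) {A : Vec ℕ n → Bool} j →
  (∀ x → sumOn p x ≡ j → A x ≡ false) → count p A j ≡ 0
count-vanishing []            zero    A≗false = cong (λ b → if b then 1 else 0) (A≗false [] refl)
count-vanishing []            (suc j) A≗false = refl
count-vanishing (inside  ∷ p) j       A≗false = ∑-zero (suc j) λ k k≤j →
  count-vanishing p (j ∸ k) λ y sum≡ → A≗false (k ∷ y) (trans (cong (k +_) sum≡) (m+[n∸m]≡n (≤-pred k≤j)))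
count-vanishing (outside ∷ p) j       A≗false = count-vanishing p j λ y → A≗false (0 ∷ y)

Disjoint : ∀ {n} → Subset n → Subset n → Set
Disjoint p q = Empty (p ∩ q)

count-∪-inside-outside : ∀ {n} {p q : Subset n} {A B : Vec ℕ (suc n) → Bool} →
  (∀ {A′ B′} → DependsOn p A′ → DependsOn q B′ →
     ∀ j → count (p ∪ q) (λ x → A′ x ∧ B′ x) j ≡ (count p A′ ⋆ count q B′) j) →
  DependsOn (inside ∷ p) A → DependsOn (outside ∷ q) B →
  ∀ j → count ((inside ∷ p) ∪ (outside ∷ q)) (λ x → A x ∧ B x) j
      ≡ (count (inside ∷ p) A ⋆ count (outside ∷ q) B) j
count-∪-inside-outside {p = p} {q} {A} {B} count-∪-tail dA dB j = begin
  ∑[ k < suc j ] count (p ∪ q) (λ y → A (k ∷ y) ∧ B (k ∷ y)) (j ∸ k)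
    ≡⟨ ∑-cong (suc j) (λ k _ → count-cong (p ∪ q) (j ∸ k) λ y _ → cong (A (k ∷ y) ∧_) (B-ignores-head k y)) ⟩
  ∑[ k < suc j ] count (p ∪ q) (λ y → A (k ∷ y) ∧ B (0 ∷ y)) (j ∸ k)
    ≡⟨ ∑-cong (suc j) (λ k _ → count-∪-tail (λ y → dA (k ∷ y)) (λ y → dB (0 ∷ y)) (j ∸ k)) ⟩
  ∑[ k < suc j ] (count p (λ y → A (k ∷ y)) ⋆ count q (λ y → B (0 ∷ y))) (j ∸ k)
    ≡⟨ ∑-shifted-⋆ (λ k → count p (λ y → A (k ∷ y))) (count q (λ y → B (0 ∷ y))) j ⟩
  (count (inside ∷ p) A ⋆ count (outside ∷ q) B) j
    ∎
  where
  open ≡-Reasoning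
  B-ignores-head : ∀ k y → B (k ∷ y) ≡ B (0 ∷ y)
  B-ignores-head k y = trans (dB (k ∷ y)) (sym (dB (0 ∷ y)))

count-∪ : ∀ {n} (p q : Subset n) {A B : Vec ℕ n → Bool} → Disjoint p q → DependsOn p A → DependsOn q B →
  ∀ j → count (p ∪ q) (λ x → A x ∧ B x) j ≡ (count p A ⋆ count q B) j
count-∪ [] [] {A} {B} _ _ _ zero with A [] | B []
... | true  | true  = refl
... | true  | false = refl
... | false | _     = refl
count-∪ [] [] {A} {B} _ _ _ (suc j) = sym (∑-zero (suc (suc j)) {λ i → count [] A i * count [] B (suc j ∸ i)} λ
  { zero    _ → *-zeroʳ (count [] A 0)
  ; (suc i) _ → refl })
count-∪ (inside  ∷ p) (inside  ∷ q) p#q _  _  = ⊥-elim (p#q (zero , here))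
count-∪ (inside  ∷ p) (outside ∷ q) p#q dA dB =
  count-∪-inside-outside (count-∪ p q (drop-∷-Empty p#q)) dA dB
count-∪ (outside ∷ p) (inside  ∷ q) {A} {B} p#q dA dB j = begin
  count (inside ∷ p ∪ q) (λ x → A x ∧ B x) j
    ≡⟨ cong (λ r → count (inside ∷ r) (λ x → A x ∧ B x) j) (∪-comm p q) ⟩
  count (inside ∷ q ∪ p) (λ x → A x ∧ B x) j
    ≡⟨ count-cong (inside ∷ q ∪ p) j (λ x _ → ∧-comm (A x) (B x)) ⟩
  count (inside ∷ q ∪ p) (λ x → B x ∧ A x) j
    ≡⟨ count-∪-inside-outside (count-∪ q p (subst Empty (∩-comm p q) (drop-∷-Empty p#q))) dB dA j ⟩
  (count (inside ∷ q) B ⋆ count (outside ∷ p) A) j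
    ≡⟨ ⋆-comm (count (inside ∷ q) B) (count (outside ∷ p) A) j ⟩
  (count (outside ∷ p) A ⋆ count (inside ∷ q) B) j
    ∎
  where open ≡-Reasoning
count-∪ (outside ∷ p) (outside ∷ q) p#q dA dB =
  count-∪ p q (drop-∷-Empty p#q) (λ y → dA (0 ∷ y)) (λ y → dB (0 ∷ y))

countTrue : ∀ {X : Set} → (X → Bool) → List X → ℕ
countTrue f []       = 0
countTrue f (x ∷ xs) = (if f x then 1 else 0) + countTrue f xs

length-filter : ∀ {X : Set} {P : X → Set} (P? : Decidable P) xs →
  length (filter P? xs) ≡ countTrue (does ∘ P?) xs
length-filter P? []       = refl
length-filter P? (x ∷ xs) with does (P? x)
... | true  = cong suc (length-filter P? xs)
... | false = length-filter P? xs

countTrue-++ : ∀ {X : Set} (f : X → Bool) xs ys → countTrue f (xs ++ ys) ≡ countTrue f xs + countTrue f ys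
countTrue-++ f []       ys = refl
countTrue-++ f (x ∷ xs) ys =
  trans (cong ((if f x then 1 else 0) +_) (countTrue-++ f xs ys)) (sym (+-assoc (if f x then 1 else 0) _ _))

countTrue-map : ∀ {X Y : Set} (f : Y → Bool) (h : X → Y) xs → countTrue f (map h xs) ≡ countTrue (f ∘ h) xs
countTrue-map f h []       = refl
countTrue-map f h (x ∷ xs) = cong ((if f (h x) then 1 else 0) +_) (countTrue-map f h xs)

countTrue-cong : ∀ {X : Set} {f g : X → Bool} xs → (∀ x → f x ≡ g x) → countTrue f xs ≡ countTrue g xs
countTrue-cong []       f≗g = refl
countTrue-cong (x ∷ xs) f≗g = cong₂ _+_ (cong (λ b → if b then 1 else 0) (f≗g x)) (countTrue-cong xs f≗g)

countTrue-false : ∀ {X : Set} {f : X → Bool} xs → (∀ x → f x ≡ false) → countTrue f xs ≡ 0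
countTrue-false []       f≗false = refl
countTrue-false (x ∷ xs) f≗false =
  cong₂ _+_ (cong (λ b → if b then 1 else 0) (f≗false x)) (countTrue-false xs f≗false)

countTrue-concatMap : ∀ {X : Set} (f : X → Bool) (F : ℕ → List X) n (g : ℕ → ℕ) →
  countTrue f (concatMap F (applyUpTo g n)) ≡ ∑[ k < n ] countTrue f (F (g k))
countTrue-concatMap f F zero    g = refl
countTrue-concatMap f F (suc n) g =
  trans (countTrue-++ f (F (g 0)) _) (cong (countTrue f (F (g 0)) +_) (countTrue-concatMap f F n (g ∘ suc)))

does-+≟-shift : ∀ {k j} h → k ≤ j → does (k + h ≟ j) ≡ does (h ≟ j ∸ k)
does-+≟-shift {k} {j} h k≤j = does-⇔ (mk⇔ (λ eq → trans (sym (m+n∸m≡n k h)) (cong (_∸ k) eq))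
                                          (λ eq → trans (cong (k +_) eq) (m+[n∸m]≡n k≤j)))
                                     (k + h ≟ j) (h ≟ j ∸ k)

does-+≟-over : ∀ {k j} h → j < k → does (k + h ≟ j) ≡ false
does-+≟-over {k} {j} h j<k = dec-false (k + h ≟ j) (λ eq → <⇒≱ j<k (subst (k ≤_) eq (m≤m+n k h)))

countTrue-box : ∀ {n} (p : Subset n) (A : Vec ℕ n → Bool) {j b} → j ≤ b →
  countTrue (λ x → does (ht x ≟ j) ∧ A x) (box p b) ≡ count p A j
countTrue-box []            A {zero}  _   = +-identityʳ _
countTrue-box []            A {suc j} _   = refl
countTrue-box (outside ∷ p) A         j≤b =
  trans (countTrue-map _ (0 ∷_) (box p _)) (countTrue-box p (λ y → A (0 ∷ y)) j≤b)
countTrue-box (inside  ∷ p) A {j} {b} j≤b = begin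
  countTrue f (concatMap (λ k → map (k ∷_) (box p b)) (upTo (suc b)))
    ≡⟨ countTrue-concatMap f (λ k → map (k ∷_) (box p b)) (suc b) id ⟩
  ∑[ k < suc b ] countTrue f (map (k ∷_) (box p b))
    ≡⟨ ∑-cong (suc b) (λ k _ → countTrue-map f (k ∷_) (box p b)) ⟩
  ∑[ k < suc b ] countTrue (λ y → f (k ∷ y)) (box p b)
    ≡⟨ ∑-trailing-zeros _ (s≤s j≤b) (λ k j<k → countTrue-false (box p b) λ y →
         cong (_∧ A (k ∷ y)) (does-+≟-over (ht y) j<k)) ⟩
  ∑[ k < suc j ] countTrue (λ y → f (k ∷ y)) (box p b)
    ≡⟨ ∑-cong (suc j) (λ k k≤j → trans
         (countTrue-cong (box p b) λ y → cong (_∧ A (k ∷ y)) (does-+≟-shift (ht y) (≤-pred k≤j)))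
         (countTrue-box p (λ y → A (k ∷ y)) (≤-trans (m∸n≤m j k) j≤b))) ⟩
  count (inside ∷ p) A j
    ∎
  where
  open ≡-Reasoning
  f : Vec ℕ _ → Bool
  f x = does (ht x ≟ j) ∧ A x

-- The coefficient of X^ℓ in (1 − X)^(−r).
multichoose : ℕ → ℕ → ℕ
multichoose zero    = one
multichoose (suc r) ℓ = ∑[ k < suc ℓ ] multichoose r (ℓ ∸ k)

count-all : ∀ {n} (p : Subset n) ℓ → count p (λ _ → true) ℓ ≡ multichoose ∣ p ∣ ℓ
count-all []            zero    = refl
count-all []            (suc ℓ) = refl
count-all (inside  ∷ p) ℓ       = ∑-cong (suc ℓ) (λ k _ → count-all p (ℓ ∸ k))
count-all (outside ∷ p) ℓ       = count-all p ℓ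

-- The Pascal recursion multichoose (1 + r) (1 + ℓ) = multichoose r (1 + ℓ) + multichoose (1 + r) ℓ
-- holds by definition; for r = 0 the truncated subtraction gives (ℓ − 1) C ℓ = [ℓ = 0].
multichoose≡C : ∀ r ℓ → multichoose r ℓ ≡ (r + ℓ ∸ 1) C ℓ
multichoose≡C zero    zero    = refl
multichoose≡C zero    (suc ℓ) = sym (k>n⇒nCk≡0 (n<1+n ℓ))
multichoose≡C (suc r) zero    = trans (+-identityʳ _) (multichoose≡C r 0)
multichoose≡C (suc r) (suc ℓ) = begin
  multichoose r (suc ℓ) + multichoose (suc r) ℓ      ≡⟨ cong₂ _+_ (multichoose≡C r (suc ℓ)) (multichoose≡C (suc r) ℓ) ⟩
  (r + suc ℓ ∸ 1) C suc ℓ + (r + ℓ) C ℓ              ≡⟨ cong (λ a → (a ∸ 1) C suc ℓ + (r + ℓ) C ℓ) (+-suc r ℓ) ⟩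
  (r + ℓ) C suc ℓ + (r + ℓ) C ℓ                      ≡⟨ +-comm ((r + ℓ) C suc ℓ) _ ⟩
  (r + ℓ) C ℓ + (r + ℓ) C suc ℓ                      ≡⟨ nCk+nC[k+1]≡[n+1]C[k+1] (r + ℓ) ℓ ⟩
  suc (r + ℓ) C suc ℓ                                ≡⟨ cong (_C suc ℓ) (+-suc r ℓ) ⟨
  (r + suc ℓ) C suc ℓ                                ∎
  where open ≡-Reasoning

sumOn-restrict : ∀ {n} (q p : Subset n) x → q ⊆ p → sumOn q x ≡ sumOn q (restrict p x)
sumOn-restrict []            []            []      _   = refl
sumOn-restrict (inside  ∷ q) (inside  ∷ p) (k ∷ x) q⊆p = cong (k +_) (sumOn-restrict q p x (drop-∷-⊆ q⊆p))
sumOn-restrict (inside  ∷ q) (outside ∷ p) (k ∷ x) q⊆p with () ← q⊆p here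
sumOn-restrict (outside ∷ q) (inside  ∷ p) (k ∷ x) q⊆p = sumOn-restrict q p x (drop-∷-⊆ q⊆p)
sumOn-restrict (outside ∷ q) (outside ∷ p) (k ∷ x) q⊆p = sumOn-restrict q p x (drop-∷-⊆ q⊆p)

∣p∪q∣≡∣p∣+∣q∣ : ∀ {n} (p q : Subset n) → Disjoint p q → ∣ p ∪ q ∣ ≡ ∣ p ∣ + ∣ q ∣
∣p∪q∣≡∣p∣+∣q∣ []            []            _   = refl
∣p∪q∣≡∣p∣+∣q∣ (inside  ∷ p) (inside  ∷ q) p#q = ⊥-elim (p#q (zero , here))
∣p∪q∣≡∣p∣+∣q∣ (inside  ∷ p) (outside ∷ q) p#q = cong suc (∣p∪q∣≡∣p∣+∣q∣ p q (drop-∷-Empty p#q))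
∣p∪q∣≡∣p∣+∣q∣ (outside ∷ p) (inside  ∷ q) p#q =
  trans (cong suc (∣p∪q∣≡∣p∣+∣q∣ p q (drop-∷-Empty p#q))) (sym (+-suc ∣ p ∣ ∣ q ∣))
∣p∪q∣≡∣p∣+∣q∣ (outside ∷ p) (outside ∷ q) p#q = ∣p∪q∣≡∣p∣+∣q∣ p q (drop-∷-Empty p#q)

⋃-++ : ∀ {n} (ps qs : List (Subset n)) → ⋃ (ps ++ qs) ≡ ⋃ ps ∪ ⋃ qs
⋃-++ []       qs = sym (∪-identityˡ (⋃ qs))
⋃-++ (p ∷ ps) qs = trans (cong (p ∪_) (⋃-++ ps qs)) (sym (∪-assoc p (⋃ ps) (⋃ qs)))

disjoint-⋃ʳ : ∀ {n} {p : Subset n} qs → All (Disjoint p) qs → Disjoint p (⋃ qs)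
disjoint-⋃ʳ {p = p} [] [] (x , x∈p∩∅) with x∈p∩q⁻ p ∅ x∈p∩∅
... | _ , x∈∅ = ∉⊥ x∈∅
disjoint-⋃ʳ {p = p} (q ∷ qs) (p#q ∷ p#qs) (x , x∈p∩) with x∈p∩q⁻ p (q ∪ ⋃ qs) x∈p∩
... | x∈p , x∈q∪ with x∈p∪q⁻ q (⋃ qs) x∈q∪
...   | inj₁ x∈q  = p#q (x , x∈p∩q⁺ (x∈p , x∈q))
...   | inj₂ x∈qs = disjoint-⋃ʳ qs p#qs (x , x∈p∩q⁺ (x∈p , x∈qs))

disjoint-⋃ : ∀ {n} (ps : List (Subset n)) {qs} → All (λ p → All (Disjoint p) qs) ps → Disjoint (⋃ ps) (⋃ qs)
disjoint-⋃ []       {qs} [] (x , x∈∅∩) with x∈p∩q⁻ ∅ (⋃ qs) x∈∅∩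
... | x∈∅ , _ = ∉⊥ x∈∅
disjoint-⋃ (p ∷ ps) {qs} (p#qs ∷ ps#qs) (x , x∈∩) with x∈p∩q⁻ (p ∪ ⋃ ps) (⋃ qs) x∈∩
... | x∈p∪ , x∈qs with x∈p∪q⁻ p (⋃ ps) x∈p∪
...   | inj₁ x∈p  = disjoint-⋃ʳ qs p#qs (x , x∈p∩q⁺ (x∈p , x∈qs))
...   | inj₂ x∈ps = disjoint-⋃ ps ps#qs (x , x∈p∩q⁺ (x∈ps , x∈qs))

AllPairs-++⁻ : ∀ {X : Set} {R : X → X → Set} xs {ys} → AllPairs R (xs ++ ys) →
  All (λ x → All (R x) ys) xs × AllPairs R ys
AllPairs-++⁻ []       Rys            = [] , Rys
AllPairs-++⁻ (x ∷ xs) (Rxys ∷ Rxsys) with AllPairs-++⁻ xs Rxsys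
... | Rxsys′ , Rys = (++⁻ʳ xs Rxys ∷ Rxsys′) , Rys

𝒟F : ∀ {n} → List (Tree n) → Subset n
𝒟F ts = ⋃ (labelsF ts)

𝒟-⊆-weaken : ∀ {n} {p q : Subset n} {vs : List (Tree n)} → p ⊆ q →
  All (λ v → 𝒟 v ⊆ p) vs → All (λ v → 𝒟 v ⊆ q) vs
𝒟-⊆-weaken p⊆q = All.map (λ v⊆p {_} x∈v → p⊆q (v⊆p x∈v))

mutual
  subtrees-⊆ : ∀ {n} (s : Tree n) → All (λ v → 𝒟 v ⊆ 𝒟 s) (subtrees s)
  subtrees-⊆ (node l ts) = ⊆-refl ∷ 𝒟-⊆-weaken (q⊆p∪q l (𝒟F ts)) (subtreesF-⊆ ts)

  subtreesF-⊆ : ∀ {n} (ts : List (Tree n)) → All (λ v → 𝒟 v ⊆ 𝒟F ts) (subtreesF ts)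
  subtreesF-⊆ []       = []
  subtreesF-⊆ (t ∷ ts) = ++⁺ (𝒟-⊆-weaken (⊆-𝒟F (p⊆p∪q (𝒟F ts))) (subtrees-⊆ t))
                             (𝒟-⊆-weaken (⊆-𝒟F (q⊆p∪q (𝒟 t) (𝒟F ts))) (subtreesF-⊆ ts))
    where
    ⊆-𝒟F : ∀ {p} → p ⊆ 𝒟 t ∪ 𝒟F ts → p ⊆ 𝒟F (t ∷ ts)
    ⊆-𝒟F = subst (_ ⊆_) (sym (⋃-++ (labels t) (labelsF ts)))

disjoint-∷ : ∀ {n} (t : Tree n) ts → AllPairs Disjoint (labelsF (t ∷ ts)) →
  Disjoint (𝒟 t) (𝒟F ts) × AllPairs Disjoint (labelsF ts)
disjoint-∷ t ts disjoint with AllPairs-++⁻ (labels t) disjoint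
... | t#ts , ts# = disjoint-⋃ (labels t) t#ts , ts#

module _ (m : ℕ) where

  constraintsHold : ∀ {n} → List (Tree n) → Vec ℕ n → Bool
  constraintsHold vs x = does (all? (λ v → sumOn (𝒟 v) x ≤? m * ∣ 𝒟 v ∣) vs)

  constraintsHold-++ : ∀ {n} (us vs : List (Tree n)) x →
    constraintsHold (us ++ vs) x ≡ constraintsHold us x ∧ constraintsHold vs x
  constraintsHold-++ []       vs x = refl
  constraintsHold-++ (u ∷ us) vs x =
    trans (cong (does (sumOn (𝒟 u) x ≤? m * ∣ 𝒟 u ∣) ∧_) (constraintsHold-++ us vs x))
          (sym (∧-assoc (does (sumOn (𝒟 u) x ≤? m * ∣ 𝒟 u ∣)) _ _))

  constraintsHold-dependsOn : ∀ {n} {p : Subset n} {vs : List (Tree n)} →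
    All (λ v → 𝒟 v ⊆ p) vs → DependsOn p (constraintsHold vs)
  constraintsHold-dependsOn                []                x = refl
  constraintsHold-dependsOn {p = p} {v ∷ _} (v⊆p ∷ vs⊆p) x =
    cong₂ _∧_ (cong (λ s → does (s ≤? m * ∣ 𝒟 v ∣)) (sumOn-restrict (𝒟 v) p x v⊆p))
              (constraintsHold-dependsOn vs⊆p x)

  Fcoeff≡count : ∀ {n} (s : Tree n) j → Fcoeff s m j ≡ count (𝒟 s) (constraintsHold (subtrees s)) j
  Fcoeff≡count s j =
    trans (length-filter _ (box (𝒟 s) j)) (countTrue-box (𝒟 s) (constraintsHold (subtrees s)) ≤-refl)

  Fcoeff-degree : ∀ {n} (s : Tree n) → DegreeAtMost (m * ∣ 𝒟 s ∣) (Fcoeff s m)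
  Fcoeff-degree s@(node _ ts) d bound<d = trans (Fcoeff≡count s d) (count-vanishing (𝒟 s) d λ x sum≡d →
    cong (_∧ constraintsHold (subtreesF ts) x)
         (dec-false (sumOn (𝒟 s) x ≤? m * ∣ 𝒟 s ∣)
                    (λ sum≤bound → <⇒≱ bound<d (subst (_≤ m * ∣ 𝒟 s ∣) sum≡d sum≤bound))))

  Fforest : ∀ {n} → List (Tree n) → ℕ → ℕ
  Fforest ts = prodPoly (map (λ t → Fcoeff t m) ts)

  Fforest-degree : ∀ {n} (ts : List (Tree n)) → AllPairs Disjoint (labelsF ts) →
    DegreeAtMost (m * ∣ 𝒟F ts ∣) (Fforest ts)
  Fforest-degree []       _        zero    ()
  Fforest-degree []       _        (suc d) _ = refl
  Fforest-degree (t ∷ ts) disjoint d bound<d with disjoint-∷ t ts disjoint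
  ... | t#ts , ts# = trans (conv≡⋆ (Fcoeff t m) (Fforest ts) d)
    (⋆-degree (Fcoeff-degree t) (Fforest-degree ts ts#) d (subst (_< d) bound-split bound<d))
    where
    bound-split : m * ∣ 𝒟F (t ∷ ts) ∣ ≡ m * ∣ 𝒟 t ∣ + m * ∣ 𝒟F ts ∣
    bound-split = begin
      m * ∣ 𝒟F (t ∷ ts) ∣          ≡⟨ cong (λ p → m * ∣ p ∣) (⋃-++ (labels t) (labelsF ts)) ⟩
      m * ∣ 𝒟 t ∪ 𝒟F ts ∣          ≡⟨ cong (m *_) (∣p∪q∣≡∣p∣+∣q∣ (𝒟 t) (𝒟F ts) t#ts) ⟩
      m * (∣ 𝒟 t ∣ + ∣ 𝒟F ts ∣)    ≡⟨ *-distribˡ-+ m ∣ 𝒟 t ∣ ∣ 𝒟F ts ∣ ⟩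
      m * ∣ 𝒟 t ∣ + m * ∣ 𝒟F ts ∣  ∎
      where open ≡-Reasoning

  count≡Fforest : ∀ {n} (ts : List (Tree n)) → AllPairs Disjoint (labelsF ts) →
    ∀ i → count (𝒟F ts) (constraintsHold (subtreesF ts)) i ≡ Fforest ts i
  count≡Fforest {n} [] _ i = trans (count-all (∅ {n}) i) (cong (λ r → multichoose r i) (∣⊥∣≡0 n))
  count≡Fforest (t ∷ ts) disjoint i with disjoint-∷ t ts disjoint
  ... | t#ts , ts# = begin
    count (𝒟F (t ∷ ts)) (constraintsHold (subtreesF (t ∷ ts))) i
      ≡⟨ cong (λ p → count p (constraintsHold (subtreesF (t ∷ ts))) i) (⋃-++ (labels t) (labelsF ts)) ⟩
    count (𝒟 t ∪ 𝒟F ts) (constraintsHold (subtrees t ++ subtreesF ts)) i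
      ≡⟨ count-cong (𝒟 t ∪ 𝒟F ts) i (λ x _ → constraintsHold-++ (subtrees t) (subtreesF ts) x) ⟩
    count (𝒟 t ∪ 𝒟F ts) (λ x → constraintsHold (subtrees t) x ∧ constraintsHold (subtreesF ts) x) i
      ≡⟨ count-∪ (𝒟 t) (𝒟F ts) t#ts (constraintsHold-dependsOn (subtrees-⊆ t))
                                     (constraintsHold-dependsOn (subtreesF-⊆ ts)) i ⟩
    (count (𝒟 t) (constraintsHold (subtrees t)) ⋆ count (𝒟F ts) (constraintsHold (subtreesF ts))) i
      ≡⟨ ⋆-cong (λ k → sym (Fcoeff≡count t k)) (count≡Fforest ts ts#) i ⟩
    (Fcoeff t m ⋆ Fforest ts) i
      ≡⟨ conv≡⋆ (Fcoeff t m) (Fforest ts) i ⟨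
    Fforest (t ∷ ts) i
      ∎
    where open ≡-Reasoning

proposition2p1 : (n : ℕ) (t : Tree n) → IsArbor t → 2 ≤ n →
    (m : ℕ) → 1 ≤ m →
    let r = ∣ rootLabel t ∣
        W = prodPoly (map (λ tk → Fcoeff tk m) (children t))
    in (j : ℕ) → j ≤ m * n →
       Fcoeff t m j ≡ sumFromTo (j ∸ m * (n ∸ r)) j (λ ℓ → ((r + ℓ ∸ 1) C ℓ) * W (j ∸ ℓ))
proposition2p1 n t@(node R ts) (_ , R#ts ∷ ts# , cover) _ m _ j j≤mn = begin
  Fcoeff t m j
    ≡⟨ Fcoeff≡count m t j ⟩
  count (R ∪ 𝒟F ts) (constraintsHold m (subtrees t)) j
    ≡⟨ count-cong (R ∪ 𝒟F ts) j root-constraint-holds ⟩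
  count (R ∪ 𝒟F ts) (λ x → true ∧ constraintsHold m (subtreesF ts) x) j
    ≡⟨ count-∪ R (𝒟F ts) R#𝒟F (λ _ → refl) (constraintsHold-dependsOn m (subtreesF-⊆ ts)) j ⟩
  (count R (λ _ → true) ⋆ count (𝒟F ts) (constraintsHold m (subtreesF ts))) j
    ≡⟨ ⋆-cong (λ ℓ → trans (count-all R ℓ) (multichoose≡C ∣ R ∣ ℓ)) (count≡Fforest m ts ts#) j ⟩
  ((λ ℓ → (∣ R ∣ + ℓ ∸ 1) C ℓ) ⋆ Fforest m ts) j
    ≡⟨ ⋆-truncate (λ ℓ → (∣ R ∣ + ℓ ∸ 1) C ℓ) (Fforest m ts) (m * (n ∸ ∣ R ∣)) W-degree j ⟩
  sumFromTo (j ∸ m * (n ∸ ∣ R ∣)) j (λ ℓ → ((∣ R ∣ + ℓ ∸ 1) C ℓ) * Fforest m ts (j ∸ ℓ))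
    ∎
  where
  open ≡-Reasoning
  R#𝒟F : Disjoint R (𝒟F ts)
  R#𝒟F = disjoint-⋃ʳ (labelsF ts) R#ts
  ∣R∪𝒟F∣≡n : ∣ R ∪ 𝒟F ts ∣ ≡ n
  ∣R∪𝒟F∣≡n = trans (cong ∣_∣ cover) (∣⊤∣≡n n)
  root-constraint-holds : ∀ x → sumOn (R ∪ 𝒟F ts) x ≡ j →
    constraintsHold m (subtrees t) x ≡ true ∧ constraintsHold m (subtreesF ts) x
  root-constraint-holds x sum≡j = cong (_∧ constraintsHold m (subtreesF ts) x)
    (dec-true (sumOn (R ∪ 𝒟F ts) x ≤? m * ∣ R ∪ 𝒟F ts ∣)
              (subst₂ _≤_ (sym sum≡j) (cong (m *_) (sym ∣R∪𝒟F∣≡n)) j≤mn))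
  ∣𝒟F∣≡n∸r : ∣ 𝒟F ts ∣ ≡ n ∸ ∣ R ∣
  ∣𝒟F∣≡n∸r = trans (sym (m+n∸m≡n ∣ R ∣ ∣ 𝒟F ts ∣))
                   (cong (_∸ ∣ R ∣) (trans (sym (∣p∪q∣≡∣p∣+∣q∣ R (𝒟F ts) R#𝒟F)) ∣R∪𝒟F∣≡n))
  W-degree : DegreeAtMost (m * (n ∸ ∣ R ∣)) (Fforest m ts)
  W-degree = subst (λ d → DegreeAtMost (m * d) (Fforest m ts)) ∣𝒟F∣≡n∸r (Fforest-degree m ts ts#)
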